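{- Let $p,q,r$ be arbitrary integers, and define integers $x,y,n$ by \[ \begin{aligned} x &= 4r(16p^2r^2 + 8pr + 4r^2 + 1)q^2 - 8r(4p^2r^2 - 4p^2r + 2pr + r^2 - p - r)q - 2r(4p^2r - 2p^2 + 2p + r - 1),\\ y &= -2(4pr + 1)(16p^2r^2 + 8pr + 4r^2 + 1)q^2 + 4(4pr + 1)(4p^2r^2 - 4p^2r+ 2pr + r^2 - p - r)q\\ &\qquad + 16p^3r^2 - 8p^3r + 8p^2r + 4pr^2 - 2p^2 - 4pr - 1,\\ n &= x^2+y^2. \end{aligned} \] Then each of the three consecutive integers $n-1$, $n$, $n+1$ can be written as a sum of two squares of integers. -}

module Defs where

open import Data.Integer using (ℤ; _+_; _-_; _*_; -_; +_)
open import Data.Product using (∃₂)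
open import Relation.Binary.PropositionalEquality using (_≡_)

SumOfTwoSquares : ℤ → Set
SumOfTwoSquares m = ∃₂ λ (a b : ℤ) → m ≡ a * a + b * b

xOf : ℤ → ℤ → ℤ → ℤ
xOf p q r =
  ((+ 4) * r * ((+ 16) * p * p * r * r + (+ 8) * p * r + (+ 4) * r * r + + 1) * q * q
   - (+ 8) * r * ((+ 4) * p * p * r * r - (+ 4) * p * p * r + (+ 2) * p * r + r * r - p - r) * q)
  - (+ 2) * r * ((+ 4) * p * p * r - (+ 2) * p * p + (+ 2) * p + r - + 1)

yOf : ℤ → ℤ → ℤ → ℤ
yOf p q r =
  (- (+ 2)) * ((+ 4) * p * r + + 1) * ((+ 16) * p * p * r * r + (+ 8) * p * r + (+ 4) * r * r + + 1) * q * q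
  + (+ 4) * ((+ 4) * p * r + + 1) * ((+ 4) * p * p * r * r - (+ 4) * p * p * r + (+ 2) * p * r + r * r - p - r) * q
  + ((+ 16) * p * p * p * r * r - (+ 8) * p * p * p * r + (+ 8) * p * p * r + (+ 4) * p * r * r
     - (+ 2) * p * p - (+ 4) * p * r - + 1)

nOf : ℤ → ℤ → ℤ → ℤ
nOf p q r = xOf p q r * xOf p q r + yOf p q r * yOf p q r

module Submission where

-- Since (x + a)² + (y + b)² = x² + y² + (2(ax + by) + a² + b²), it suffices that x and y
-- satisfy two linear relations: the defect 2(ax + by) + a² + b² equals −1 for
-- (a, b) = (2(4pr + 1)q + 2p, 4rq + 1) and equals 1 for (a, b) = (4pr + 1, 2r).
-- Translating the point (x, y) by these vectors then represents n − 1 and n + 1.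

open import Defs
open import Data.Integer using (ℤ; _+_; _-_; +_; _*_; -_)
open import Data.Integer.Solver using (module +-*-Solver)
open import Data.Integer.Tactic.RingSolver using (solve-∀)
open import Data.Product using (_×_; _,_)
open import Relation.Binary.PropositionalEquality using (_≡_; refl; sym)

norm-shift : ∀ x y a b →
  (x + a) * (x + a) + (y + b) * (y + b) ≡ x * x + y * y + ((+ 2) * (a * x + b * y) + a * a + b * b)
norm-shift = solve-∀

sumOfTwoSquares-shift : ∀ x y a b {k} → (+ 2) * (a * x + b * y) + a * a + b * b ≡ k →
  SumOfTwoSquares (x * x + y * y + k)
sumOfTwoSquares-shift x y a b refl = x + a , y + b , sym (norm-shift x y a b)

module _ where
  open +-*-Solver

  -- Term-for-term transcriptions of xOf and yOf into the solver's syntax,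
  -- so that their evaluations are definitionally xOf and yOf.
  xPoly yPoly : Polynomial 3 → Polynomial 3 → Polynomial 3 → Polynomial 3
  xPoly p q r =
    (con (+ 4) :* r :* (con (+ 16) :* p :* p :* r :* r :+ con (+ 8) :* p :* r :+ con (+ 4) :* r :* r :+ con (+ 1)) :* q :* q
     :- con (+ 8) :* r :* (con (+ 4) :* p :* p :* r :* r :- con (+ 4) :* p :* p :* r :+ con (+ 2) :* p :* r :+ r :* r :- p :- r) :* q)
    :- con (+ 2) :* r :* (con (+ 4) :* p :* p :* r :- con (+ 2) :* p :* p :+ con (+ 2) :* p :+ r :- con (+ 1))
  yPoly p q r =
    con (- (+ 2)) :* (con (+ 4) :* p :* r :+ con (+ 1)) :* (con (+ 16) :* p :* p :* r :* r :+ con (+ 8) :* p :* r :+ con (+ 4) :* r :* r :+ con (+ 1)) :* q :* q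
    :+ con (+ 4) :* (con (+ 4) :* p :* r :+ con (+ 1)) :* (con (+ 4) :* p :* p :* r :* r :- con (+ 4) :* p :* p :* r :+ con (+ 2) :* p :* r :+ r :* r :- p :- r) :* q
    :+ (con (+ 16) :* p :* p :* p :* r :* r :- con (+ 8) :* p :* p :* p :* r :+ con (+ 8) :* p :* p :* r :+ con (+ 4) :* p :* r :* r
       :- con (+ 2) :* p :* p :- con (+ 4) :* p :* r :- con (+ 1))

  shiftDefect : (a b x y : Polynomial 3) → Polynomial 3
  shiftDefect a b x y = con (+ 2) :* (a :* x :+ b :* y) :+ a :* a :+ b :* b

  xyOf-lowering-shift : ∀ p q r →
    let a = (+ 2) * ((+ 4) * p * r + + 1) * q + (+ 2) * p
        b = (+ 4) * r * q + + 1
    in (+ 2) * (a * xOf p q r + b * yOf p q r) + a * a + b * b ≡ - + 1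
  xyOf-lowering-shift = solve 3 (λ p q r →
    shiftDefect (con (+ 2) :* (con (+ 4) :* p :* r :+ con (+ 1)) :* q :+ con (+ 2) :* p)
                (con (+ 4) :* r :* q :+ con (+ 1))
                (xPoly p q r) (yPoly p q r)
      := con (- + 1)) refl

  xyOf-raising-shift : ∀ p q r →
    let c = (+ 4) * p * r + + 1
        d = (+ 2) * r
    in (+ 2) * (c * xOf p q r + d * yOf p q r) + c * c + d * d ≡ + 1
  xyOf-raising-shift = solve 3 (λ p q r →
    shiftDefect (con (+ 4) :* p :* r :+ con (+ 1)) (con (+ 2) :* r) (xPoly p q r) (yPoly p q r)
      := con (+ 1)) refl

theorem3p1 : (p q r : ℤ) →
    SumOfTwoSquares (nOf p q r - + 1) × SumOfTwoSquares (nOf p q r) × SumOfTwoSquares (nOf p q r + + 1)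
theorem3p1 p q r =
  sumOfTwoSquares-shift x y a b (xyOf-lowering-shift p q r) ,
  (x , y , refl) ,
  sumOfTwoSquares-shift x y c d (xyOf-raising-shift p q r)
  where
  x y a b c d : ℤ
  x = xOf p q r
  y = yOf p q r
  a = (+ 2) * ((+ 4) * p * r + + 1) * q + (+ 2) * p
  b = (+ 4) * r * q + + 1
  c = (+ 4) * p * r + + 1
  d = (+ 2) * r
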